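{- For every $w\in\mathfrak{S}_n$, $$D_w^{\vee}=\bigcup_{v\in[w,w_0]_R} C(v),$$ where $D_w^\vee=\{x\in\mathbb{R}^n : \langle y,x\rangle\ge0 \text{ for all } y\in D_w\}$ is the dual cone with respect to the standard inner product.
   Context: Permutations are in one-line notation; $\ell$ is length, $w_0$ the longest element of $\mathfrak{S}_n$, $t_{a,b}$ the transposition of $a,b$. Right weak order: $u_1\le_R u_2$ iff $u_2=u_1s_{i_1}\cdots s_{i_k}$ with simple reflections $s_{i_j}$ and $\ell(u_1s_{i_1}\cdots s_{i_j})=\ell(u_1)+j$ for all $j$; $[u_1,u_2]_R=\{x : u_1\le_R x\le_R u_2\}$. $C(v)=\{(a_1,\dots,a_n)\in\mathbb{R}^n: a_{v(1)}\le\cdots\le a_{v(n)}\}$. $E(w)=\{(w(i),w(j)) : 1\le i<j\le n,\ \ell(w)-\ell(t_{w(i),w(j)}w)=1\}$ (equivalently $w(i)>w(j)$ and $w(k)\notin[w(j),w(i)]$ for all $i<k<j$), and $D_w$ is the cone in $\mathbb{R}^n$ spanned by $\{e_b-e_a : (a,b)\in E(w)\}$.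
   Formalization: The cones D_w, D_w^∨ and C(v) are taken in ℚ^n instead of ℝ^n, with rational coefficients for the generators e_b − e_a of D_w. -}

module Defs where

open import Data.Nat using (ℕ; zero; suc; _≟_)
open import Relation.Nullary using (yes; no)
open import Data.Empty using (⊥)
open import Data.Fin using (Fin; toℕ; opposite; zero; suc) renaming (_<_ to _<ᶠ_; _<?_ to _<ᶠ?_)
open import Data.Fin.Permutation using (Permutation′; _⟨$⟩ʳ_)
open import Data.Fin.Permutation.Components using (transpose)
open import Data.List using (List; length; filter; cartesianProduct; allFin)
open import Data.Product using (Σ; ∃; _×_; _,_; proj₁; proj₂)
open import Relation.Nullary.Decidable using (_×-dec_)
open import Relation.Binary.PropositionalEquality using (_≡_)
open import Data.Rational using (ℚ; 0ℚ; 1ℚ; _+_; _*_; _-_; _≤_)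

-- One-line notation: a permutation of {1..n} is represented on Fin n
-- (value k : Fin n stands for k+1); w(i) is w ⟨$⟩ʳ i.

ℓ : ∀ {n} → (Fin n → Fin n) → ℕ
ℓ {n} x = length (filter (λ p → (proj₁ p <ᶠ? proj₂ p) ×-dec (x (proj₂ p) <ᶠ? x (proj₁ p)))
                         (cartesianProduct (allFin n) (allFin n)))

-- Right weak order: u ≤R y iff y is obtained from u by successively
-- multiplying on the right by simple reflections s_i, each step raising
-- length by exactly one.  s_i = transpose i j with toℕ j = toℕ i + 1,
-- and (x s_i)(k) = x (s_i k).
data _≤R_ {n} (u : Fin n → Fin n) : (Fin n → Fin n) → Set where
  ≤R-refl : ∀ {y} → (∀ k → u k ≡ y k) → u ≤R y
  ≤R-step : ∀ {x y} (i j : Fin n) → toℕ j ≡ suc (toℕ i) →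
            u ≤R x →
            (∀ k → y k ≡ x (transpose i j k)) →
            ℓ y ≡ suc (ℓ x) →
            u ≤R y

w₀ : ∀ {n} → Fin n → Fin n
w₀ = opposite

InE : ∀ {n} → Permutation′ n → Fin n → Fin n → Set
InE {n} w a b = Σ (Fin n) λ i → Σ (Fin n) λ j →
  (i <ᶠ j) × (w ⟨$⟩ʳ i ≡ a) × (w ⟨$⟩ʳ j ≡ b) ×
  (suc (ℓ (λ k → transpose a b (w ⟨$⟩ʳ k))) ≡ ℓ (w ⟨$⟩ʳ_))

∑ : ∀ {n} → (Fin n → ℚ) → ℚ
∑ {zero}  f = 0ℚ
∑ {suc n} f = f zero + ∑ (λ k → f (suc k))

e : ∀ {n} → Fin n → Fin n → ℚ
e a k with toℕ a ≟ toℕ k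
... | yes _ = 1ℚ
... | no  _ = 0ℚ

⟪_,_⟫ : ∀ {n} → (Fin n → ℚ) → (Fin n → ℚ) → ℚ
⟪ y , x ⟫ = ∑ (λ k → y k * x k)

InD : ∀ {n} → Permutation′ n → (Fin n → ℚ) → Set
InD {n} w y = Σ (Fin n → Fin n → ℚ) λ c →
  (∀ a b → 0ℚ ≤ c a b) ×
  (∀ a b → (c a b ≡ 0ℚ → ⊥) → InE w a b) ×
  (∀ k → y k ≡ ∑ (λ a → ∑ (λ b → c a b * (e b k - e a k))))

InDual : ∀ {n} → Permutation′ n → (Fin n → ℚ) → Set
InDual w x = ∀ y → InD w y → 0ℚ ≤ ⟪ y , x ⟫

InC : ∀ {n} → Permutation′ n → (Fin n → ℚ) → Set
InC {n} v x = ∀ (i j : Fin n) → toℕ j ≡ suc (toℕ i) → x (v ⟨$⟩ʳ i) ≤ x (v ⟨$⟩ʳ j)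

{-# OPTIONS --safe #-}
module Submission where

-- x lies in the dual of D_w iff x_a ≤ x_b for every (a, b) ∈ E(w).  An inversion of w whose
-- positions enclose an intermediate value splits into two shorter inversions, and one that encloses
-- none is an element of E(w); so x is then weakly increasing across every inversion of w.
-- Bubble-sorting w by the values of x therefore only ever swaps adjacent ascents of w: it climbs the
-- right weak order from w to some v with x ∈ C(v), and every v lies below w₀.  Conversely,
-- inversions persist upwards in the right weak order, so x ∈ C(v) with w ≤_R v forces x_a ≤ x_b
-- along E(w), which makes ⟨y, x⟩ ≥ 0 on D_w.
-- The length bookkeeping rests on one fact: swapping positions i < j with w(i) < w(j) raises ℓ, by
-- exactly one when no value between w(i) and w(j) sits between the positions.  It is reduced to
-- adjacent swaps through t_ij = t_mj t_im t_mj with m = j - 1.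

open import Defs

open import Data.Bool using (if_then_else_; true; false)
open import Data.Fin as Fin using (Fin; zero; suc; toℕ; inject₁) renaming (_<_ to _<ᶠ_; _≤_ to _≤ᶠ_; _<?_ to _<ᶠ?_)
open import Data.Fin.Properties
  using (toℕ-injective; suc-injective; toℕ-inject₁; toℕ<n; toℕ-fromℕ; ≤fromℕ; opposite-prop; <-asym; <-cmp; <⇒≢; ≤∧≢⇒<; any?)
open import Data.Fin.Permutation as Perm using (Permutation′; _⟨$⟩ʳ_; _∘ₚ_; lift₀-transpose)
open import Data.Fin.Permutation.Components using (transpose)
open import Data.List using (List; []; _∷_; length; filter; tabulate; map; _++_; cartesianProduct; allFin)
open import Data.List.Properties using (filter-++; length-++; length-map; length-filter; length-tabulate; map-tabulate)
open import Data.Nat as ℕ using (ℕ; zero; suc)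
import Data.Nat.Properties as ℕ
open import Data.Product using (Σ; ∃; _×_; _,_; proj₁; proj₂)
open import Data.Rational using (ℚ; 0ℚ; 1ℚ; _+_; _*_; _-_; -_; _≤_; _<_; _<?_; nonNegative)
import Data.Rational.Properties as ℚ
open import Data.Rational.Solver using (module +-*-Solver)
open import Data.Sum using (_⊎_; inj₁; inj₂)
open import Data.Unit using (⊤; tt)
open import Function using (_∘_; flip)
open import Function.Bundles using (_⇔_; mk⇔; Injection)
open import Function.Definitions using (Injective)
open import Function.Properties.Inverse using (↔⇒↣)
open import Relation.Binary.Core using (Rel)
open import Relation.Binary.Definitions using (Reflexive; Transitive; tri<; tri≈; tri>)
open import Relation.Binary.PropositionalEquality
open import Relation.Nullary using (Dec; does; yes; no; ¬_; contradiction)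
open import Relation.Nullary.Decidable using (_×-dec_; dec-true; dec-false)
open import Relation.Unary using (Decidable)

open import Algebra.Properties.CommutativeMonoid.Sum ℕ.+-0-commutativeMonoid using (sum; sum-cong-≗; sum-permute)
open import Algebra.Properties.CommutativeSemigroup ℕ.+-commutativeSemigroup using (x∙yz≈y∙xz)

open +-*-Solver

-- Finite sums and the standard pairing

∑-cong : ∀ {n} {f g : Fin n → ℚ} → (∀ k → f k ≡ g k) → ∑ f ≡ ∑ g
∑-cong {zero}  _   = refl
∑-cong {suc n} f≗g = cong₂ _+_ (f≗g zero) (∑-cong (f≗g ∘ suc))

∑-zero : ∀ {n} {f : Fin n → ℚ} → (∀ k → f k ≡ 0ℚ) → ∑ f ≡ 0ℚ
∑-zero {zero}  _   = refl
∑-zero {suc n} f≗0 = cong₂ _+_ (f≗0 zero) (∑-zero (f≗0 ∘ suc))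

∑-distrib-+ : ∀ {n} (f g : Fin n → ℚ) → ∑ (λ k → f k + g k) ≡ ∑ f + ∑ g
∑-distrib-+ {zero}  f g = refl
∑-distrib-+ {suc n} f g = trans (cong (f zero + g zero +_) (∑-distrib-+ (f ∘ suc) (g ∘ suc)))
  (solve 4 (λ a b c d → (a :+ b) :+ (c :+ d) := (a :+ c) :+ (b :+ d)) refl
     (f zero) (g zero) (∑ (f ∘ suc)) (∑ (g ∘ suc)))

*-distribˡ-∑ : ∀ {n} (c : ℚ) (f : Fin n → ℚ) → c * ∑ f ≡ ∑ (λ k → c * f k)
*-distribˡ-∑ {zero}  c f = ℚ.*-zeroʳ c
*-distribˡ-∑ {suc n} c f =
  trans (ℚ.*-distribˡ-+ c (f zero) (∑ (f ∘ suc))) (cong (c * f zero +_) (*-distribˡ-∑ c (f ∘ suc)))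

*-distribʳ-∑ : ∀ {n} (c : ℚ) (f : Fin n → ℚ) → ∑ f * c ≡ ∑ (λ k → f k * c)
*-distribʳ-∑ c f = trans (ℚ.*-comm (∑ f) c) (trans (*-distribˡ-∑ c f) (∑-cong (λ k → ℚ.*-comm c (f k))))

∑-comm : ∀ {m n} (f : Fin m → Fin n → ℚ) → ∑ (λ a → ∑ (f a)) ≡ ∑ (λ b → ∑ (λ a → f a b))
∑-comm {zero}  {n} f = sym (∑-zero {n} (λ _ → refl))
∑-comm {suc m}     f = trans (cong (∑ (f zero) +_) (∑-comm (f ∘ suc)))
  (sym (∑-distrib-+ (f zero) (λ b → ∑ (λ a → f (suc a) b))))

∑-supported-at : ∀ {n} {f : Fin n → ℚ} (b : Fin n) → (∀ k → k ≢ b → f k ≡ 0ℚ) → ∑ f ≡ f b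
∑-supported-at {suc n} {f} zero f≗0 = trans (cong (f zero +_) (∑-zero (λ k → f≗0 (suc k) (λ ())))) (ℚ.+-identityʳ _)
∑-supported-at {suc n} (suc b) f≗0 =
  trans (cong₂ _+_ (f≗0 zero (λ ())) (∑-supported-at b (λ k k≢b → f≗0 (suc k) (k≢b ∘ suc-injective))))
        (ℚ.+-identityˡ _)

∑-nonNeg : ∀ {n} {f : Fin n → ℚ} → (∀ k → 0ℚ ≤ f k) → 0ℚ ≤ ∑ f
∑-nonNeg {zero}  _  = ℚ.≤-refl
∑-nonNeg {suc n} f≥0 = ℚ.+-mono-≤ (f≥0 zero) (∑-nonNeg (f≥0 ∘ suc))

e-diag : ∀ {n} (a : Fin n) → e a a ≡ 1ℚ
e-diag a with toℕ a ℕ.≟ toℕ a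
... | yes _   = refl
... | no a≢a = contradiction refl a≢a

e-offdiag : ∀ {n} {a k : Fin n} → k ≢ a → e a k ≡ 0ℚ
e-offdiag {a = a} {k} k≢a with toℕ a ℕ.≟ toℕ k
... | yes a≡k = contradiction (toℕ-injective (sym a≡k)) k≢a
... | no _    = refl

pairing-e : ∀ {n} (b : Fin n) (x : Fin n → ℚ) → ⟪ e b , x ⟫ ≡ x b
pairing-e b x = trans (∑-supported-at b (λ k k≢b → trans (cong (_* x k) (e-offdiag k≢b)) (ℚ.*-zeroˡ (x k))))
                      (trans (cong (_* x b) (e-diag b)) (ℚ.*-identityˡ (x b)))

pairing-∑ : ∀ {m n} (y : Fin m → Fin n → ℚ) (x : Fin n → ℚ) →
            ⟪ (λ k → ∑ (λ a → y a k)) , x ⟫ ≡ ∑ (λ a → ⟪ y a , x ⟫)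
pairing-∑ y x = trans (∑-cong (λ k → *-distribʳ-∑ (x k) (λ a → y a k))) (∑-comm (λ k a → y a k * x k))

pairing-generator : ∀ {n} (c : ℚ) (a b : Fin n) (x : Fin n → ℚ) →
                    ⟪ (λ k → c * (e b k - e a k)) , x ⟫ ≡ c * (x b - x a)
pairing-generator c a b x = begin
  ∑ (λ k → c * (e b k - e a k) * x k)
    ≡⟨ ∑-cong (λ k → expand (e b k) (e a k) (x k)) ⟩
  ∑ (λ k → c * (e b k * x k) + - c * (e a k * x k))
    ≡⟨ ∑-distrib-+ (λ k → c * (e b k * x k)) (λ k → - c * (e a k * x k)) ⟩
  ∑ (λ k → c * (e b k * x k)) + ∑ (λ k → - c * (e a k * x k))
    ≡⟨ cong₂ _+_ (sym (*-distribˡ-∑ c (λ k → e b k * x k))) (sym (*-distribˡ-∑ (- c) (λ k → e a k * x k))) ⟩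
  c * ⟪ e b , x ⟫ + - c * ⟪ e a , x ⟫
    ≡⟨ cong₂ (λ u v → c * u + - c * v) (pairing-e b x) (pairing-e a x) ⟩
  c * x b + - c * x a
    ≡⟨ solve 3 (λ c u v → c :* u :+ (:- c) :* v := c :* (u :- v)) refl c (x b) (x a) ⟩
  c * (x b - x a) ∎
  where
  open ≡-Reasoning
  expand : ∀ u v z → c * (u - v) * z ≡ c * (u * z) + - c * (v * z)
  expand = solve 4 (λ c u v z → c :* (u :- v) :* z := c :* (u :* z) :+ (:- c) :* (v :* z)) refl c

pairing-combination : ∀ {n} (c : Fin n → Fin n → ℚ) (x : Fin n → ℚ) →
  ⟪ (λ k → ∑ (λ a → ∑ (λ b → c a b * (e b k - e a k)))) , x ⟫ ≡ ∑ (λ a → ∑ (λ b → c a b * (x b - x a)))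
pairing-combination c x = trans (pairing-∑ (λ a k → ∑ (λ b → c a b * (e b k - e a k))) x)
  (∑-cong (λ a → trans (pairing-∑ (λ b k → c a b * (e b k - e a k)) x)
                       (∑-cong (λ b → pairing-generator (c a b) a b x))))

p≤q⇒0≤q-p : ∀ {p q : ℚ} → p ≤ q → 0ℚ ≤ q - p
p≤q⇒0≤q-p {p} {q} p≤q = subst (_≤ q - p) (ℚ.+-inverseʳ p) (ℚ.+-monoˡ-≤ (- p) p≤q)

0≤q-p⇒p≤q : ∀ {p q : ℚ} → 0ℚ ≤ q - p → p ≤ q
0≤q-p⇒p≤q {p} {q} 0≤q-p =
  subst₂ _≤_ (ℚ.+-identityˡ p) (solve 2 (λ p q → q :- p :+ p := q) refl p q) (ℚ.+-monoˡ-≤ p 0≤q-p)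

*-nonNeg : ∀ {p q : ℚ} → 0ℚ ≤ p → 0ℚ ≤ q → 0ℚ ≤ p * q
*-nonNeg {p} {q} 0≤p 0≤q = subst (_≤ p * q) (ℚ.*-zeroʳ p) (ℚ.*-monoˡ-≤-nonNeg p {{nonNegative 0≤p}} 0≤q)

e-nonNeg : ∀ {n} (a k : Fin n) → 0ℚ ≤ e a k
e-nonNeg a k with toℕ a ℕ.≟ toℕ k
... | yes _ = ℚ.nonNegative⁻¹ 1ℚ
... | no _  = ℚ.≤-refl

∑∑-e : ∀ {n} (a b : Fin n) (g : Fin n → Fin n → ℚ) →
       ∑ (λ a′ → ∑ (λ b′ → e a a′ * e b b′ * g a′ b′)) ≡ g a b
∑∑-e a b g = begin
  ∑ (λ a′ → ∑ (λ b′ → e a a′ * e b b′ * g a′ b′))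
    ≡⟨ ∑-cong (λ a′ → trans (∑-cong (λ b′ → ℚ.*-assoc (e a a′) (e b b′) (g a′ b′)))
                            (sym (*-distribˡ-∑ (e a a′) (λ b′ → e b b′ * g a′ b′)))) ⟩
  ∑ (λ a′ → e a a′ * ⟪ e b , g a′ ⟫)
    ≡⟨ ∑-cong (λ a′ → cong (e a a′ *_) (pairing-e b (g a′))) ⟩
  ⟪ e a , (λ a′ → g a′ b) ⟫
    ≡⟨ pairing-e a (λ a′ → g a′ b) ⟩
  g a b ∎
  where open ≡-Reasoning

-- Transpositions

module _ {n : ℕ} where

  transpose-matchˡ : (i j : Fin n) → transpose i j i ≡ j
  transpose-matchˡ i j with i Fin.≟ i
  ... | yes _   = refl
  ... | no i≢i = contradiction refl i≢i

  transpose-matchʳ : (i j : Fin n) → transpose i j j ≡ i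
  transpose-matchʳ i j with j Fin.≟ i
  ... | yes j≡i = j≡i
  ... | no _ with j Fin.≟ j
  ...   | yes _   = refl
  ...   | no j≢j = contradiction refl j≢j

  transpose-mismatch : {i j k : Fin n} → k ≢ i → k ≢ j → transpose i j k ≡ k
  transpose-mismatch {i} {j} {k} k≢i k≢j with k Fin.≟ i
  ... | yes k≡i = contradiction k≡i k≢i
  ... | no _ with k Fin.≟ j
  ...   | yes k≡j = contradiction k≡j k≢j
  ...   | no _    = refl

  transpose-involutive : (i j k : Fin n) → transpose i j (transpose i j k) ≡ k
  transpose-involutive i j k with k Fin.≟ i
  ... | yes refl = transpose-matchʳ k j
  ... | no k≢i with k Fin.≟ j
  ...   | yes refl = transpose-matchˡ i k
  ...   | no k≢j   = transpose-mismatch k≢i k≢j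

transpose-suc : ∀ {n} (i j k : Fin n) → transpose (suc i) (suc j) (suc k) ≡ suc (transpose i j k)
transpose-suc i j k = lift₀-transpose i j (suc k)

transpose-injective : ∀ {n} (i j : Fin n) → Injective _≡_ _≡_ (transpose i j)
transpose-injective i j {k} {l} tk≡tl =
  trans (sym (transpose-involutive i j k)) (trans (cong (transpose i j) tk≡tl) (transpose-involutive i j l))

transpose-conjugate : ∀ {n} {i m j : Fin n} → i ≢ m → m ≢ j → i ≢ j → ∀ k →
                      transpose i j k ≡ transpose m j (transpose i m (transpose m j k))
transpose-conjugate {i = i} {m} {j} i≢m m≢j i≢j k = by-cases (k Fin.≟ i) (k Fin.≟ j) (k Fin.≟ m)
  where
  open ≡-Reasoning
  by-cases : Dec (k ≡ i) → Dec (k ≡ j) → Dec (k ≡ m) →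
             transpose i j k ≡ transpose m j (transpose i m (transpose m j k))
  by-cases (yes refl) _ _ = begin
    transpose k j k                                 ≡⟨ transpose-matchˡ k j ⟩
    j                                               ≡⟨ transpose-matchˡ m j ⟨
    transpose m j m                                 ≡⟨ cong (transpose m j) (transpose-matchˡ k m) ⟨
    transpose m j (transpose k m k)                 ≡⟨ cong (transpose m j ∘ transpose k m) (transpose-mismatch i≢m i≢j) ⟨
    transpose m j (transpose k m (transpose m j k)) ∎
  by-cases (no k≢i) (yes refl) _ = begin
    transpose i k k                                 ≡⟨ transpose-matchʳ i k ⟩
    i                                               ≡⟨ transpose-mismatch i≢m i≢j ⟨
    transpose m k i                                 ≡⟨ cong (transpose m k) (transpose-matchʳ i m) ⟨
    transpose m k (transpose i m m)                 ≡⟨ cong (transpose m k ∘ transpose i m) (transpose-matchʳ m k) ⟨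
    transpose m k (transpose i m (transpose m k k)) ∎
  by-cases (no k≢i) (no k≢j) (yes refl) = begin
    transpose i j k                                 ≡⟨ transpose-mismatch k≢i k≢j ⟩
    k                                               ≡⟨ transpose-matchʳ k j ⟨
    transpose k j j                                 ≡⟨ cong (transpose k j) (transpose-mismatch (i≢j ∘ sym) (m≢j ∘ sym)) ⟨
    transpose k j (transpose i k j)                 ≡⟨ cong (transpose k j ∘ transpose i k) (transpose-matchˡ k j) ⟨
    transpose k j (transpose i k (transpose k j k)) ∎
  by-cases (no k≢i) (no k≢j) (no k≢m) = begin
    transpose i j k                                 ≡⟨ transpose-mismatch k≢i k≢j ⟩
    k                                               ≡⟨ transpose-mismatch k≢m k≢j ⟨
    transpose m j k                                 ≡⟨ cong (transpose m j) (transpose-mismatch k≢i k≢m) ⟨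
    transpose m j (transpose i m k)                 ≡⟨ cong (transpose m j ∘ transpose i m) (transpose-mismatch k≢m k≢j) ⟨
    transpose m j (transpose i m (transpose m j k)) ∎

transpose-natural : ∀ {n m} {w : Fin n → Fin m} → Injective _≡_ _≡_ w → ∀ i j k →
                    transpose (w i) (w j) (w k) ≡ w (transpose i j k)
transpose-natural {w = w} w-inj i j k = by-cases (k Fin.≟ i) (k Fin.≟ j)
  where
  by-cases : Dec (k ≡ i) → Dec (k ≡ j) → transpose (w i) (w j) (w k) ≡ w (transpose i j k)
  by-cases (yes refl) _        = trans (transpose-matchˡ (w k) (w j)) (cong w (sym (transpose-matchˡ k j)))
  by-cases (no _)   (yes refl) = trans (transpose-matchʳ (w i) (w k)) (cong w (sym (transpose-matchʳ i k)))
  by-cases (no k≢i) (no k≢j)   =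
    trans (transpose-mismatch (k≢i ∘ w-inj) (k≢j ∘ w-inj)) (cong w (sym (transpose-mismatch k≢i k≢j)))

⟨$⟩ʳ-injective : ∀ {n} (π : Permutation′ n) → Injective _≡_ _≡_ (π ⟨$⟩ʳ_)
⟨$⟩ʳ-injective π = Injection.injective (↔⇒↣ π)

Adjacent : ∀ {n} → Fin n → Fin n → Set
Adjacent i j = toℕ j ≡ suc (toℕ i)

transpose-adjacent-monotone : ∀ {n} {i j p q : Fin n} → Adjacent i j → p <ᶠ q → ¬ (p ≡ i × q ≡ j) →
                              transpose i j p <ᶠ transpose i j q
transpose-adjacent-monotone {i = i} {j} {p} {q} i⋖j p<q ¬ij = by-cases (p Fin.≟ i) (p Fin.≟ j) (q Fin.≟ i) (q Fin.≟ j)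
  where
  i<j : i <ᶠ j
  i<j = ℕ.≤-reflexive (sym i⋖j)
  by-cases : Dec (p ≡ i) → Dec (p ≡ j) → Dec (q ≡ i) → Dec (q ≡ j) → transpose i j p <ᶠ transpose i j q
  by-cases (yes refl) _ _ (yes refl) = contradiction (refl , refl) ¬ij
  by-cases (yes refl) _ (yes refl) _ = contradiction p<q (ℕ.<-irrefl refl)
  by-cases (yes refl) _ (no q≢i) (no q≢j) =
    subst₂ _<ᶠ_ (sym (transpose-matchˡ p j)) (sym (transpose-mismatch q≢i q≢j))
      (≤∧≢⇒< (subst (ℕ._≤ toℕ q) (sym i⋖j) p<q) (q≢j ∘ sym))
  by-cases (no _) (yes refl) (no q≢i) (no q≢j) =
    subst₂ _<ᶠ_ (sym (transpose-matchʳ i p)) (sym (transpose-mismatch q≢i q≢j)) (ℕ.<-trans i<j p<q)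
  by-cases (no _) (yes refl) (yes refl) _ = contradiction (ℕ.<-trans i<j p<q) (ℕ.<-irrefl refl)
  by-cases (no _) (yes refl) _ (yes refl) = contradiction p<q (ℕ.<-irrefl refl)
  by-cases (no p≢i) (no p≢j) (yes refl) _ =
    subst₂ _<ᶠ_ (sym (transpose-mismatch p≢i p≢j)) (sym (transpose-matchˡ q j)) (ℕ.<-trans p<q i<j)
  by-cases (no p≢i) (no p≢j) (no _) (yes refl) =
    subst₂ _<ᶠ_ (sym (transpose-mismatch p≢i p≢j)) (sym (transpose-matchʳ i q))
      (≤∧≢⇒< (ℕ.s≤s⁻¹ (subst (toℕ p ℕ.<_) i⋖j p<q)) p≢i)
  by-cases (no p≢i) (no p≢j) (no q≢i) (no q≢j) =
    subst₂ _<ᶠ_ (sym (transpose-mismatch p≢i p≢j)) (sym (transpose-mismatch q≢i q≢j)) p<q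

predecessor : ∀ {n} {j : Fin n} {t : ℕ} → toℕ j ≡ suc t → Σ (Fin n) (λ k → Adjacent k j × toℕ k ≡ t)
predecessor {j = suc j} j≡1+t =
  inject₁ j , cong suc (sym (toℕ-inject₁ j)) , trans (toℕ-inject₁ j) (ℕ.suc-injective j≡1+t)

distance : ∀ {n} {i j : Fin n} → i <ᶠ j → ∃ λ d → toℕ j ≡ suc (d ℕ.+ toℕ i)
distance {i = i} i<j with ℕ.m≤n⇒∃[o]m+o≡n i<j
... | d , 1+i+d≡j = d , sym (trans (cong suc (ℕ.+-comm d (toℕ i))) 1+i+d≡j)

module _ {a ℓ} {A : Set a} {_≼_ : Rel A ℓ} (≼-refl : Reflexive _≼_) (≼-trans : Transitive _≼_) where

  monotone-from-adjacent : ∀ {n} (g : Fin n → A) → (∀ {i j} → Adjacent i j → g i ≼ g j) →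
                           ∀ {i j} → i ≤ᶠ j → g i ≼ g j
  monotone-from-adjacent g step {i} i≤j with ℕ.m≤n⇒∃[o]m+o≡n i≤j
  ... | o , i+o≡j = by-distance o (sym (trans (ℕ.+-comm o (toℕ i)) i+o≡j))
    where
    by-distance : ∀ d {j} → toℕ j ≡ d ℕ.+ toℕ i → g i ≼ g j
    by-distance zero    j≡i = subst (λ k → g i ≼ g k) (toℕ-injective (sym j≡i)) ≼-refl
    by-distance (suc d) j≡1+d+i with predecessor j≡1+d+i
    ... | k , k⋖j , k≡d+i = ≼-trans (by-distance d k≡d+i) (step k⋖j)

descending⇒opposite : ∀ {n} (f : Fin n → Fin n) → (∀ {i j} → Adjacent i j → f j <ᶠ f i) →
                      ∀ k → f k ≡ Fin.opposite k
descending⇒opposite {suc n} f descending k = toℕ-injective (trans fk≡n∸k (sym (opposite-prop k)))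
  where
  -- f(k) + k is non-increasing in k, at most n at k = 0 and at least n at k = n.
  weight : Fin (suc n) → ℕ
  weight l = toℕ (f l) ℕ.+ toℕ l

  weight-step : ∀ {i j} → Adjacent i j → weight j ℕ.≤ weight i
  weight-step {i} {j} i⋖j = subst (ℕ._≤ weight i) (sym (trans (cong (toℕ (f j) ℕ.+_) i⋖j) (ℕ.+-suc _ _)))
                                  (ℕ.+-monoˡ-≤ (toℕ i) (descending i⋖j))

  weight-antitone : ∀ {i j} → i ≤ᶠ j → weight j ℕ.≤ weight i
  weight-antitone = monotone-from-adjacent {_≼_ = flip ℕ._≤_} ℕ.≤-refl (flip ℕ.≤-trans) weight weight-step

  weight≡n : weight k ≡ n
  weight≡n = ℕ.≤-antisym
    (ℕ.≤-trans (weight-antitone ℕ.z≤n) (ℕ.≤-trans (ℕ.≤-reflexive (ℕ.+-identityʳ _)) (ℕ.s≤s⁻¹ (toℕ<n (f zero)))))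
    (ℕ.≤-trans (subst (ℕ._≤ weight (Fin.fromℕ n)) (toℕ-fromℕ n) (ℕ.m≤n+m _ _)) (weight-antitone (≤fromℕ k)))

  fk≡n∸k : toℕ (f k) ≡ n ℕ.∸ toℕ k
  fk≡n∸k = trans (sym (ℕ.m+n∸n≡m (toℕ (f k)) (toℕ k))) (cong (ℕ._∸ toℕ k) weight≡n)

adjacent-search : ∀ {n r} {R : Fin n → Fin n → Set r} → (∀ i j → Dec (R i j)) →
                  (∃ λ i → ∃ λ j → Adjacent i j × R i j) ⊎ (∀ {i j} → Adjacent i j → ¬ R i j)
adjacent-search R? with any? (λ i → any? (λ j → (toℕ j ℕ.≟ suc (toℕ i)) ×-dec R? i j))
... | yes (i , j , i⋖j , r) = inj₁ (i , j , i⋖j , r)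
... | no ∄ij                = inj₂ (λ {i} {j} i⋖j r → ∄ij (i , j , i⋖j , r))

-- Counting inversions

𝟙 : ∀ {p} {P : Set p} → Dec P → ℕ
𝟙 d = if does d then 1 else 0

-- ℓ recast as a double sum over positions, so that it unfolds one position at a time:
-- inversions f = countBelow (f 0) (f ∘ suc) + inversions (f ∘ suc) holds by computation.
inversions : ∀ {n m} → (Fin n → Fin m) → ℕ
inversions f = sum (λ p → sum (λ q → 𝟙 ((p <ᶠ? q) ×-dec (f q <ᶠ? f p))))

countBelow : ∀ {n m} → Fin m → (Fin n → Fin m) → ℕ
countBelow a g = sum (λ q → 𝟙 (g q <ᶠ? a))

module _ {a p} {A : Set a} {P : A → Set p} (P? : Decidable P) where

  length-filter-tabulate : ∀ {n} (f : Fin n → A) → length (filter P? (tabulate f)) ≡ sum (λ i → 𝟙 (P? (f i)))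
  length-filter-tabulate {zero}  f = refl
  length-filter-tabulate {suc n} f with does (P? (f zero))
  ... | true  = cong suc (length-filter-tabulate (f ∘ suc))
  ... | false = length-filter-tabulate (f ∘ suc)

module _ {a b p} {A : Set a} {B : Set b} {P : A × B → Set p} (P? : Decidable P) where

  length-filter-cartesianProduct : ∀ {n} (g : Fin n → A) (ys : List B) →
    length (filter P? (cartesianProduct (tabulate g) ys)) ≡ sum (λ i → length (filter P? (map (g i ,_) ys)))
  length-filter-cartesianProduct {zero}  g ys = refl
  length-filter-cartesianProduct {suc n} g ys = begin
    length (filter P? (map (g zero ,_) ys ++ cartesianProduct (tabulate (g ∘ suc)) ys))
      ≡⟨ cong length (filter-++ P? (map (g zero ,_) ys) _) ⟩
    length (filter P? (map (g zero ,_) ys) ++ filter P? (cartesianProduct (tabulate (g ∘ suc)) ys))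
      ≡⟨ length-++ (filter P? (map (g zero ,_) ys)) ⟩
    length (filter P? (map (g zero ,_) ys)) ℕ.+ length (filter P? (cartesianProduct (tabulate (g ∘ suc)) ys))
      ≡⟨ cong (length (filter P? (map (g zero ,_) ys)) ℕ.+_) (length-filter-cartesianProduct (g ∘ suc) ys) ⟩
    sum (λ i → length (filter P? (map (g i ,_) ys))) ∎
    where open ≡-Reasoning

ℓ≡inversions : ∀ {n} (f : Fin n → Fin n) → ℓ f ≡ inversions f
ℓ≡inversions {n} f = trans (length-filter-cartesianProduct P? (λ p → p) (allFin n))
  (sum-cong-≗ (λ p → trans (cong (length ∘ filter P?) (map-tabulate (λ q → q) (p ,_)))
                           (length-filter-tabulate P? (p ,_))))
  where
  P? : Decidable (λ (pq : Fin n × Fin n) → proj₁ pq <ᶠ proj₂ pq × f (proj₂ pq) <ᶠ f (proj₁ pq))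
  P? (p , q) = (p <ᶠ? q) ×-dec (f q <ᶠ? f p)

length-cartesianProduct : ∀ {a b} {A : Set a} {B : Set b} (xs : List A) (ys : List B) →
                          length (cartesianProduct xs ys) ≡ length xs ℕ.* length ys
length-cartesianProduct []       ys = refl
length-cartesianProduct (x ∷ xs) ys = begin
  length (map (x ,_) ys ++ cartesianProduct xs ys)          ≡⟨ length-++ (map (x ,_) ys) ⟩
  length (map (x ,_) ys) ℕ.+ length (cartesianProduct xs ys)
    ≡⟨ cong₂ ℕ._+_ (length-map (x ,_) ys) (length-cartesianProduct xs ys) ⟩
  length ys ℕ.+ length xs ℕ.* length ys                      ∎
  where open ≡-Reasoning

ℓ-bound : ∀ {n} (f : Fin n → Fin n) → ℓ f ℕ.≤ n ℕ.* n
ℓ-bound {n} f = ℕ.≤-trans (length-filter _ (cartesianProduct (allFin n) (allFin n))) (ℕ.≤-reflexive (begin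
  length (cartesianProduct (allFin n) (allFin n)) ≡⟨ length-cartesianProduct (allFin n) (allFin n) ⟩
  length (allFin n) ℕ.* length (allFin n)
    ≡⟨ cong₂ ℕ._*_ (length-tabulate {n = n} (λ k → k)) (length-tabulate {n = n} (λ k → k)) ⟩
  n ℕ.* n                                         ∎))
  where open ≡-Reasoning

inversions-cong : ∀ {n m} {f g : Fin n → Fin m} → (∀ k → f k ≡ g k) → inversions f ≡ inversions g
inversions-cong f≗g = sum-cong-≗ (λ p → sum-cong-≗ (λ q →
  cong₂ (λ u v → 𝟙 ((p <ᶠ? q) ×-dec (u <ᶠ? v))) (f≗g q) (f≗g p)))

ℓ-cong : ∀ {n} {f g : Fin n → Fin n} → (∀ k → f k ≡ g k) → ℓ f ≡ ℓ g
ℓ-cong {f = f} {g} f≗g = trans (ℓ≡inversions f) (trans (inversions-cong f≗g) (sym (ℓ≡inversions g)))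

ℓ-transpose-values : ∀ {n} {w : Fin n → Fin n} → Injective _≡_ _≡_ w → ∀ i j →
                     ℓ (λ k → transpose (w i) (w j) (w k)) ≡ inversions (w ∘ transpose i j)
ℓ-transpose-values {w = w} w-inj i j =
  trans (ℓ-cong (transpose-natural w-inj i j)) (ℓ≡inversions (w ∘ transpose i j))

countBelow-transpose : ∀ {n m} (a : Fin m) (g : Fin n → Fin m) (i j : Fin n) →
                       countBelow a (g ∘ transpose i j) ≡ countBelow a g
countBelow-transpose a g i j = sym (sum-permute (λ q → 𝟙 (g q <ᶠ? a)) (Perm.transpose i j))

inversions-adjacent-ascent : ∀ {n m} (f : Fin n → Fin m) {i j : Fin n} → Adjacent i j → f i <ᶠ f j →
                             inversions (f ∘ transpose i j) ≡ suc (inversions f)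
inversions-adjacent-ascent {suc (suc n)} {m} f {zero} {suc zero} refl f0<f1
  rewrite dec-true (f zero <ᶠ? f (suc zero)) f0<f1 | dec-false (f (suc zero) <ᶠ? f zero) (<-asym f0<f1)
  = cong suc (x∙yz≈y∙xz (countBelow (f (suc zero)) rest) (countBelow (f zero) rest) (inversions rest))
  where
  rest : Fin n → Fin m
  rest k = f (suc (suc k))
inversions-adjacent-ascent f {suc i} {suc j} i⋖j fi<fj = begin
  countBelow (f zero) (f ∘ transpose (suc i) (suc j) ∘ suc) ℕ.+ inversions (f ∘ transpose (suc i) (suc j) ∘ suc)
    ≡⟨ cong₂ ℕ._+_ (sum-cong-≗ (λ q → cong (λ v → 𝟙 (f v <ᶠ? f zero)) (transpose-suc i j q)))
                   (inversions-cong (cong f ∘ transpose-suc i j)) ⟩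
  countBelow (f zero) (f ∘ suc ∘ transpose i j) ℕ.+ inversions (f ∘ suc ∘ transpose i j)
    ≡⟨ cong₂ ℕ._+_ (countBelow-transpose (f zero) (f ∘ suc) i j)
                   (inversions-adjacent-ascent (f ∘ suc) (ℕ.suc-injective i⋖j) fi<fj) ⟩
  countBelow (f zero) (f ∘ suc) ℕ.+ suc (inversions (f ∘ suc))
    ≡⟨ ℕ.+-suc _ _ ⟩
  suc (inversions f) ∎
  where open ≡-Reasoning

inversions-adjacent-descent : ∀ {n m} (f : Fin n → Fin m) {i j : Fin n} → Adjacent i j → f j <ᶠ f i →
                              suc (inversions (f ∘ transpose i j)) ≡ inversions f
inversions-adjacent-descent f {i} {j} i⋖j fj<fi = begin
  suc (inversions (f ∘ transpose i j))
    ≡⟨ inversions-adjacent-ascent (f ∘ transpose i j) i⋖j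
         (subst₂ _<ᶠ_ (sym (cong f (transpose-matchˡ i j))) (sym (cong f (transpose-matchʳ i j))) fj<fi) ⟨
  inversions (f ∘ transpose i j ∘ transpose i j)
    ≡⟨ inversions-cong (cong f ∘ transpose-involutive i j) ⟩
  inversions f ∎
  where open ≡-Reasoning

NothingBetween : ∀ {n m} → (Fin n → Fin m) → Fin n → Fin n → Set
NothingBetween f i j = ∀ {k} → i <ᶠ k → k <ᶠ j → ¬ (f i <ᶠ f k × f k <ᶠ f j)

RaisesInversions : ∀ {n m} → (Fin n → Fin m) → Fin n → Fin n → Set
RaisesInversions f i j = inversions f ℕ.< inversions (f ∘ transpose i j) ×
                         (NothingBetween f i j → inversions (f ∘ transpose i j) ≡ suc (inversions f))

module Conjugation {n m} (f : Fin n → Fin m) {i mid j : Fin n} (i<mid : i <ᶠ mid) (mid⋖j : Adjacent mid j) where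

  mid<j : mid <ᶠ j
  mid<j = ℕ.≤-reflexive (sym mid⋖j)

  i≢mid : i ≢ mid
  i≢mid = <⇒≢ i<mid

  mid≢j : mid ≢ j
  mid≢j = <⇒≢ mid<j

  i≢j : i ≢ j
  i≢j = <⇒≢ (ℕ.<-trans i<mid mid<j)

  f′ : Fin n → Fin m
  f′ = f ∘ transpose mid j

  h : Fin n → Fin m
  h = f′ ∘ transpose i mid

  f′-i : f′ i ≡ f i
  f′-i = cong f (transpose-mismatch i≢mid i≢j)

  f′-mid : f′ mid ≡ f j
  f′-mid = cong f (transpose-matchˡ mid j)

  h-mid : h mid ≡ f i
  h-mid = trans (cong f′ (transpose-matchʳ i mid)) f′-i

  h-j : h j ≡ f mid
  h-j = trans (cong f′ (transpose-mismatch (i≢j ∘ sym) (mid≢j ∘ sym))) (cong f (transpose-matchʳ mid j))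

  inversions-split : inversions (f ∘ transpose i j) ≡ inversions (h ∘ transpose mid j)
  inversions-split = inversions-cong (cong f ∘ transpose-conjugate i≢mid mid≢j i≢j)

  nothingBetween′ : NothingBetween f i j → NothingBetween f′ i mid
  nothingBetween′ none {k} i<k k<mid (f′i<f′k , f′k<f′mid) =
    none i<k k<j (subst₂ _<ᶠ_ f′-i f′-k f′i<f′k , subst₂ _<ᶠ_ f′-k f′-mid f′k<f′mid)
    where
    k<j : k <ᶠ j
    k<j = ℕ.<-trans k<mid mid<j
    f′-k : f′ k ≡ f k
    f′-k = cong f (transpose-mismatch (<⇒≢ k<mid) (<⇒≢ k<j))

-- f ∘ t_ij = ((f ∘ t_mj) ∘ t_im) ∘ t_mj: two adjacent swaps around a transposition of shorter span.
-- Each adjacent swap changes the count by ±1, according to where f(mid) lies relative to f(i) < f(j).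
raisesInversions-conjugate : ∀ {n m} {f : Fin n → Fin m} → Injective _≡_ _≡_ f → ∀ {i mid j} →
  (i<mid : i <ᶠ mid) (mid⋖j : Adjacent mid j) → f i <ᶠ f j →
  RaisesInversions (Conjugation.f′ f i<mid mid⋖j) i mid → RaisesInversions f i j
raisesInversions-conjugate {f = f} f-inj {i} {mid} {j} i<mid mid⋖j fi<fj (ih< , ih≡)
  rewrite Conjugation.inversions-split f i<mid mid⋖j with <-cmp (f mid) (f i)
... | tri< fmid<fi _ _ =
  ℕ.s≤s⁻¹ (subst₂ ℕ._<_ e₁ (sym e₃) ih<) ,
  λ none → ℕ.suc-injective (trans e₃ (trans (ih≡ (nothingBetween′ none)) (cong suc e₁)))
  where
  open Conjugation f i<mid mid⋖j
  e₁ = inversions-adjacent-ascent f mid⋖j (ℕ.<-trans fmid<fi fi<fj)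
  e₃ = inversions-adjacent-descent h mid⋖j (subst₂ _<ᶠ_ (sym h-j) (sym h-mid) fmid<fi)
... | tri≈ _ fmid≡fi _ = contradiction (sym (f-inj fmid≡fi)) (Conjugation.i≢mid f i<mid mid⋖j)
... | tri> _ _ fi<fmid with <-cmp (f mid) (f j)
...   | tri< fmid<fj _ _ =
  ℕ.<-trans (subst (inversions f ℕ.<_) (sym e₁) (ℕ.n<1+n _))
    (subst (inversions f′ ℕ.<_) (sym e₃) (ℕ.<-trans ih< (ℕ.n<1+n _))) ,
  λ none → contradiction (fi<fmid , fmid<fj) (none i<mid mid<j)
  where
  open Conjugation f i<mid mid⋖j
  e₁ = inversions-adjacent-ascent f mid⋖j fmid<fj
  e₃ = inversions-adjacent-ascent h mid⋖j (subst₂ _<ᶠ_ (sym h-mid) (sym h-j) fi<fmid)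
...   | tri≈ _ fmid≡fj _ = contradiction (f-inj fmid≡fj) (Conjugation.mid≢j f i<mid mid⋖j)
...   | tri> _ _ fj<fmid =
  subst (inversions f ℕ.<_) (sym e₃) (ℕ.s≤s (subst (ℕ._≤ inversions h) e₁ ih<)) ,
  λ none → trans e₃ (cong suc (trans (ih≡ (nothingBetween′ none)) e₁))
  where
  open Conjugation f i<mid mid⋖j
  e₁ = inversions-adjacent-descent f mid⋖j fj<fmid
  e₃ = inversions-adjacent-ascent h mid⋖j (subst₂ _<ᶠ_ (sym h-mid) (sym h-j) fi<fmid)

raisesInversions : ∀ {n m} {f : Fin n → Fin m} → Injective _≡_ _≡_ f → ∀ {i j} → i <ᶠ j → f i <ᶠ f j →
                   RaisesInversions f i j
raisesInversions f-inj i<j with distance i<j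
... | d , j≡1+d+i = by-distance d f-inj j≡1+d+i
  where
  by-distance : ∀ d {n m} {f : Fin n → Fin m} → Injective _≡_ _≡_ f → ∀ {i j} → toℕ j ≡ suc (d ℕ.+ toℕ i) →
                f i <ᶠ f j → RaisesInversions f i j
  by-distance zero {f = f} _ i⋖j fi<fj = ℕ.≤-reflexive (sym ascent) , λ _ → ascent
    where ascent = inversions-adjacent-ascent f i⋖j fi<fj
  by-distance (suc d) {f = f} f-inj {i} {j} i+2+d≡j fi<fj with predecessor i+2+d≡j
  ... | mid , mid⋖j , mid≡i+1+d = raisesInversions-conjugate f-inj i<mid mid⋖j fi<fj
          (by-distance d (transpose-injective mid j ∘ f-inj) mid≡i+1+d
             (subst₂ _<ᶠ_ (sym f′-i) (sym f′-mid) fi<fj))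
    where
    i<mid : i <ᶠ mid
    i<mid = subst (toℕ i ℕ.<_) (sym mid≡i+1+d) (ℕ.s≤s (ℕ.m≤n+m (toℕ i) d))
    open Conjugation f i<mid mid⋖j

-- The right weak order

≤R-cong : ∀ {n} {u y y′ : Fin n → Fin n} → u ≤R y → (∀ k → y k ≡ y′ k) → u ≤R y′
≤R-cong (≤R-refl u≗y)                   y≗y′ = ≤R-refl (λ k → trans (u≗y k) (y≗y′ k))
≤R-cong (≤R-step i j i⋖j u≤x y≗xt ℓy≡1+ℓx) y≗y′ =
  ≤R-step i j i⋖j u≤x (λ k → trans (sym (y≗y′ k)) (y≗xt k)) (trans (sym (ℓ-cong y≗y′)) ℓy≡1+ℓx)

Precedes : ∀ {n} → (Fin n → Fin n) → Fin n → Fin n → Set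
Precedes u a b = ∃ λ p → ∃ λ q → p <ᶠ q × u p ≡ a × u q ≡ b

≤R-preserves-inversion : ∀ {n} {u y : Fin n → Fin n} {a b : Fin n} →
                         u ≤R y → b <ᶠ a → Precedes u a b → Precedes y a b
≤R-preserves-inversion (≤R-refl u≗y) _ (p , q , p<q , up≡a , uq≡b) =
  p , q , p<q , trans (sym (u≗y p)) up≡a , trans (sym (u≗y q)) uq≡b
≤R-preserves-inversion (≤R-step {x} {y} i j i⋖j u≤x y≗xt ℓy≡1+ℓx) b<a u-precedes
  with ≤R-preserves-inversion u≤x b<a u-precedes
... | p , q , p<q , xp≡a , xq≡b with (p Fin.≟ i) ×-dec (q Fin.≟ j)
...   | yes (refl , refl) = contradiction ascent (ℕ.<-asym descent)
  where
  descent : inversions (x ∘ transpose p q) ℕ.< inversions x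
  descent = ℕ.≤-reflexive (inversions-adjacent-descent x i⋖j (subst₂ _<ᶠ_ (sym xq≡b) (sym xp≡a) b<a))
  ascent : inversions x ℕ.< inversions (x ∘ transpose p q)
  ascent = ℕ.≤-reflexive (sym (begin
    inversions (x ∘ transpose p q) ≡⟨ inversions-cong y≗xt ⟨
    inversions y                   ≡⟨ ℓ≡inversions y ⟨
    ℓ y                            ≡⟨ ℓy≡1+ℓx ⟩
    suc (ℓ x)                      ≡⟨ cong suc (ℓ≡inversions x) ⟩
    suc (inversions x)             ∎))
    where open ≡-Reasoning
...   | no ¬ij = transpose i j p , transpose i j q , transpose-adjacent-monotone i⋖j p<q ¬ij ,
                 moved xp≡a , moved xq≡b
  where
  moved : ∀ {k c} → x k ≡ c → y (transpose i j k) ≡ c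
  moved {k} xk≡c = trans (y≗xt (transpose i j k)) (trans (cong x (transpose-involutive i j k)) xk≡c)

AscentInto : ∀ {n} → (Permutation′ n → Set) → Permutation′ n → Set
AscentInto P u = ∃ λ i → ∃ λ j → Adjacent i j × u ⟨$⟩ʳ i <ᶠ u ⟨$⟩ʳ j × P (Perm.transpose i j ∘ₚ u)

module Climb {n} (Invariant Goal : Permutation′ n → Set)
             (advance : ∀ u → Invariant u → Goal u ⊎ AscentInto Invariant u) where

  private
    -- Each step raises ℓ by one and ℓ ≤ n², so n² + 1 steps suffice.
    climb-within : ∀ fuel {w} u → n ℕ.* n ℕ.< ℓ (u ⟨$⟩ʳ_) ℕ.+ fuel → w ≤R (u ⟨$⟩ʳ_) → Invariant u →
                   Σ (Permutation′ n) λ v → w ≤R (v ⟨$⟩ʳ_) × Goal v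
    climb-within zero u n²<ℓu _ _ =
      contradiction (ℕ.≤-trans (ℕ.≤-reflexive (ℕ.+-identityʳ _)) (ℓ-bound (u ⟨$⟩ʳ_))) (ℕ.<⇒≱ n²<ℓu)
    climb-within (suc fuel) u n²<ℓu+1+fuel w≤u inv-u with advance u inv-u
    ... | inj₁ goal-u = u , w≤u , goal-u
    ... | inj₂ (i , j , i⋖j , ui<uj , inv-u′) =
      climb-within fuel u′
        (subst (n ℕ.* n ℕ.<_) (trans (ℕ.+-suc _ fuel) (cong (ℕ._+ fuel) (sym ℓu′≡1+ℓu))) n²<ℓu+1+fuel)
                   (≤R-step i j i⋖j w≤u (λ _ → refl) ℓu′≡1+ℓu) inv-u′
      where
      u′ = Perm.transpose i j ∘ₚ u
      ℓu′≡1+ℓu : ℓ (u′ ⟨$⟩ʳ_) ≡ suc (ℓ (u ⟨$⟩ʳ_))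
      ℓu′≡1+ℓu = trans (ℓ≡inversions (u′ ⟨$⟩ʳ_))
                   (trans (inversions-adjacent-ascent (u ⟨$⟩ʳ_) i⋖j ui<uj) (cong suc (sym (ℓ≡inversions (u ⟨$⟩ʳ_)))))

  climb : ∀ {w} u → w ≤R (u ⟨$⟩ʳ_) → Invariant u → Σ (Permutation′ n) λ v → w ≤R (v ⟨$⟩ʳ_) × Goal v
  climb u = climb-within (suc (n ℕ.* n)) u (ℕ.m≤n+m (suc (n ℕ.* n)) (ℓ (u ⟨$⟩ʳ_)))

Descending : ∀ {n} → Permutation′ n → Set
Descending u = ∀ {i j} → Adjacent i j → u ⟨$⟩ʳ j <ᶠ u ⟨$⟩ʳ i

descending-or-ascent : ∀ {n} (u : Permutation′ n) → ⊤ → Descending u ⊎ AscentInto (λ _ → ⊤) u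
descending-or-ascent u _ with adjacent-search (λ i j → u ⟨$⟩ʳ i <ᶠ? u ⟨$⟩ʳ j)
... | inj₁ (i , j , i⋖j , ui<uj) = inj₂ (i , j , i⋖j , ui<uj , tt)
... | inj₂ no-ascent            = inj₁ (λ i⋖j → ≤∧≢⇒< (ℕ.≮⇒≥ (no-ascent i⋖j))
                                        (λ uj≡ui → <⇒≢ (ℕ.≤-reflexive (sym i⋖j)) (sym (⟨$⟩ʳ-injective u uj≡ui))))

≤R-w₀ : ∀ {n} (v : Permutation′ n) → (v ⟨$⟩ʳ_) ≤R w₀
≤R-w₀ v with Climb.climb (λ _ → ⊤) Descending descending-or-ascent v (≤R-refl (λ _ → refl)) tt
... | u , v≤u , descending = ≤R-cong v≤u (descending⇒opposite (u ⟨$⟩ʳ_) descending)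

-- The cone D_w and its dual

module _ {n} (w : Permutation′ n) where

  private
    w-inj : Injective _≡_ _≡_ (w ⟨$⟩ʳ_)
    w-inj = ⟨$⟩ʳ-injective w

  InE⇒inversion : ∀ {a b} → InE w a b → Precedes (w ⟨$⟩ʳ_) a b × b <ᶠ a
  InE⇒inversion (i , j , i<j , refl , refl , ℓ-drops) = (i , j , i<j , refl , refl) , descent
    where
    inversions-drop : suc (inversions ((w ⟨$⟩ʳ_) ∘ transpose i j)) ≡ inversions (w ⟨$⟩ʳ_)
    inversions-drop = trans (cong suc (sym (ℓ-transpose-values w-inj i j))) (trans ℓ-drops (ℓ≡inversions (w ⟨$⟩ʳ_)))
    descent : w ⟨$⟩ʳ j <ᶠ w ⟨$⟩ʳ i
    descent with <-cmp (w ⟨$⟩ʳ i) (w ⟨$⟩ʳ j)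
    ... | tri< wi<wj _ _ = contradiction (proj₁ (raisesInversions w-inj i<j wi<wj))
                                         (ℕ.<-asym (ℕ.≤-reflexive inversions-drop))
    ... | tri≈ _ wi≡wj _ = contradiction (w-inj wi≡wj) (<⇒≢ i<j)
    ... | tri> _ _ wj<wi = wj<wi

  cover⇒InE : ∀ {p q} → p <ᶠ q → w ⟨$⟩ʳ q <ᶠ w ⟨$⟩ʳ p → NothingBetween ((w ⟨$⟩ʳ_) ∘ transpose p q) p q →
              InE w (w ⟨$⟩ʳ p) (w ⟨$⟩ʳ q)
  cover⇒InE {p} {q} p<q wq<wp none = p , q , p<q , refl , refl , (begin
    suc (ℓ (λ k → transpose (w ⟨$⟩ʳ p) (w ⟨$⟩ʳ q) (w ⟨$⟩ʳ k))) ≡⟨ cong suc (ℓ-transpose-values w-inj p q) ⟩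
    suc (inversions g)                                          ≡⟨ proj₂ (raisesInversions g-inj p<q gp<gq) none ⟨
    inversions (g ∘ transpose p q)
      ≡⟨ inversions-cong (cong (w ⟨$⟩ʳ_) ∘ transpose-involutive p q) ⟩
    inversions (w ⟨$⟩ʳ_)                                        ≡⟨ ℓ≡inversions (w ⟨$⟩ʳ_) ⟨
    ℓ (w ⟨$⟩ʳ_)                                                 ∎)
    where
    open ≡-Reasoning
    g : Fin n → Fin n
    g = (w ⟨$⟩ʳ_) ∘ transpose p q
    g-inj : Injective _≡_ _≡_ g
    g-inj = transpose-injective p q ∘ w-inj
    gp<gq : g p <ᶠ g q
    gp<gq = subst₂ _<ᶠ_ (sym (cong (w ⟨$⟩ʳ_) (transpose-matchˡ p q))) (sym (cong (w ⟨$⟩ʳ_) (transpose-matchʳ p q)))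
                        wq<wp

InC⇒monotone : ∀ {n} {v : Permutation′ n} {x : Fin n → ℚ} → InC v x →
               ∀ {p q} → p ≤ᶠ q → x (v ⟨$⟩ʳ p) ≤ x (v ⟨$⟩ʳ q)
InC⇒monotone {v = v} {x} v∈C = monotone-from-adjacent {_≼_ = _≤_} ℚ.≤-refl ℚ.≤-trans (x ∘ (v ⟨$⟩ʳ_)) (v∈C _ _)

module _ {n} (w : Permutation′ n) (x : Fin n → ℚ) where

  InDual⇒InE-monotone : InDual w x → ∀ {a b} → InE w a b → x a ≤ x b
  -- Test x against the generator e_b - e_a itself, i.e. against the coefficients c = e_a ⊗ e_b.
  InDual⇒InE-monotone dual {a} {b} ab∈E = 0≤q-p⇒p≤q (subst (0ℚ ≤_) pairing (dual _ y∈D))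
    where
    c : Fin n → Fin n → ℚ
    c a′ b′ = e a a′ * e b b′
    support : ∀ a′ b′ → c a′ b′ ≢ 0ℚ → InE w a′ b′
    support a′ b′ c≢0 with a′ Fin.≟ a | b′ Fin.≟ b
    ... | yes refl | yes refl = ab∈E
    ... | no a′≢a  | _        = contradiction (trans (cong (_* e b b′) (e-offdiag a′≢a)) (ℚ.*-zeroˡ (e b b′))) c≢0
    ... | _        | no b′≢b  = contradiction (trans (cong (e a a′ *_) (e-offdiag b′≢b)) (ℚ.*-zeroʳ (e a a′))) c≢0
    y∈D : InD w (λ k → ∑ (λ a′ → ∑ (λ b′ → c a′ b′ * (e b′ k - e a′ k))))
    y∈D = c , (λ a′ b′ → *-nonNeg (e-nonNeg a a′) (e-nonNeg b b′)) , support , (λ k → refl)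
    pairing : ⟪ (λ k → ∑ (λ a′ → ∑ (λ b′ → c a′ b′ * (e b′ k - e a′ k)))) , x ⟫ ≡ x b - x a
    pairing = trans (pairing-combination c x) (∑∑-e a b (λ a′ b′ → x b′ - x a′))

  chamber⇒InDual : ∀ {v} → (w ⟨$⟩ʳ_) ≤R (v ⟨$⟩ʳ_) → InC v x → InDual w x
  chamber⇒InDual {v} w≤v v∈C y (c , c≥0 , c-support , y≡∑c) =
    subst (0ℚ ≤_) (sym (trans (∑-cong (λ k → cong (_* x k) (y≡∑c k))) (pairing-combination c x)))
          (∑-nonNeg (λ a → ∑-nonNeg (λ b → term-nonNeg a b)))
    where
    InE-monotone : ∀ {a b} → InE w a b → x a ≤ x b
    InE-monotone ab∈E with InE⇒inversion w ab∈E
    ... | w-precedes , b<a with ≤R-preserves-inversion w≤v b<a w-precedes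
    ...   | p , q , p<q , refl , refl = InC⇒monotone {v = v} {x} v∈C (ℕ.<⇒≤ p<q)
    term-nonNeg : ∀ a b → 0ℚ ≤ c a b * (x b - x a)
    term-nonNeg a b with c a b ℚ.≟ 0ℚ
    ... | yes c≡0 = subst (0ℚ ≤_) (sym (trans (cong (_* (x b - x a)) c≡0) (ℚ.*-zeroˡ (x b - x a)))) ℚ.≤-refl
    ... | no c≢0  = *-nonNeg (c≥0 a b) (p≤q⇒0≤q-p (InE-monotone (c-support a b c≢0)))

IncreasingOnInversions : ∀ {n} → (Fin n → ℚ) → Permutation′ n → Set
IncreasingOnInversions x u = ∀ {p q} → p <ᶠ q → u ⟨$⟩ʳ q <ᶠ u ⟨$⟩ʳ p → x (u ⟨$⟩ʳ p) ≤ x (u ⟨$⟩ʳ q)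

module _ {n} (x : Fin n → ℚ) where

  InDual⇒increasingOnInversions : ∀ w → InDual w x → IncreasingOnInversions x w
  InDual⇒increasingOnInversions w dual {p} {q} = within-span (toℕ q) (ℕ.m≤m+n (toℕ q) (toℕ p))
    where
    -- N bounds the span q - p, which both halves of a split inversion shorten.
    within-span : ∀ N {p q} → toℕ q ℕ.≤ N ℕ.+ toℕ p → p <ᶠ q → w ⟨$⟩ʳ q <ᶠ w ⟨$⟩ʳ p →
                  x (w ⟨$⟩ʳ p) ≤ x (w ⟨$⟩ʳ q)
    within-span zero    q≤p p<q _ = contradiction q≤p (ℕ.<⇒≱ p<q)
    within-span (suc N) {p} {q} q≤1+N+p p<q wq<wp
      with any? (λ k → (p <ᶠ? k) ×-dec (k <ᶠ? q) ×-dec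
                        (w ⟨$⟩ʳ q <ᶠ? w ⟨$⟩ʳ k) ×-dec (w ⟨$⟩ʳ k <ᶠ? w ⟨$⟩ʳ p))
    ... | yes (k , p<k , k<q , wq<wk , wk<wp) =
      ℚ.≤-trans (within-span N (ℕ.s≤s⁻¹ (ℕ.≤-trans k<q q≤1+N+p)) p<k wk<wp)
                (within-span N (ℕ.≤-trans q≤1+N+p
                                  (ℕ.≤-trans (ℕ.≤-reflexive (sym (ℕ.+-suc N (toℕ p)))) (ℕ.+-monoʳ-≤ N p<k)))
                               k<q wq<wk)
    ... | no ∄k = InDual⇒InE-monotone w x dual (cover⇒InE w p<q wq<wp none)
      where
      none : NothingBetween ((w ⟨$⟩ʳ_) ∘ transpose p q) p q
      none {k} p<k k<q (gp<gk , gk<gq) = ∄k (k , p<k , k<q , subst₂ _<ᶠ_ gp gk gp<gk , subst₂ _<ᶠ_ gk gq gk<gq)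
        where
        gp = cong (w ⟨$⟩ʳ_) (transpose-matchˡ p q)
        gq = cong (w ⟨$⟩ʳ_) (transpose-matchʳ p q)
        gk = cong (w ⟨$⟩ʳ_) (transpose-mismatch (<⇒≢ p<k ∘ sym) (<⇒≢ k<q))

  increasingOnInversions-swap : ∀ {u i j} → IncreasingOnInversions x u → Adjacent i j →
    x (u ⟨$⟩ʳ j) < x (u ⟨$⟩ʳ i) → u ⟨$⟩ʳ i <ᶠ u ⟨$⟩ʳ j × IncreasingOnInversions x (Perm.transpose i j ∘ₚ u)
  increasingOnInversions-swap {u} {i} {j} increasing i⋖j xuj<xui = ui<uj , increasing′
    where
    ui<uj : u ⟨$⟩ʳ i <ᶠ u ⟨$⟩ʳ j
    ui<uj with <-cmp (u ⟨$⟩ʳ i) (u ⟨$⟩ʳ j)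
    ... | tri< ui<uj _ _ = ui<uj
    ... | tri≈ _ ui≡uj _ = contradiction (⟨$⟩ʳ-injective u ui≡uj) (<⇒≢ (ℕ.≤-reflexive (sym i⋖j)))
    ... | tri> _ _ uj<ui = contradiction (ℚ.<-≤-trans xuj<xui (increasing (ℕ.≤-reflexive (sym i⋖j)) uj<ui)) (ℚ.<-irrefl refl)
    increasing′ : IncreasingOnInversions x (Perm.transpose i j ∘ₚ u)
    increasing′ {p} {q} p<q = by-cases ((p Fin.≟ i) ×-dec (q Fin.≟ j))
      where
      by-cases : Dec (p ≡ i × q ≡ j) → u ⟨$⟩ʳ transpose i j q <ᶠ u ⟨$⟩ʳ transpose i j p →
                 x (u ⟨$⟩ʳ transpose i j p) ≤ x (u ⟨$⟩ʳ transpose i j q)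
      by-cases (yes (refl , refl)) _ = subst₂ (λ k l → x (u ⟨$⟩ʳ k) ≤ x (u ⟨$⟩ʳ l))
        (sym (transpose-matchˡ p q)) (sym (transpose-matchʳ p q)) (ℚ.<⇒≤ xuj<xui)
      by-cases (no ¬ij) = increasing (transpose-adjacent-monotone i⋖j p<q ¬ij)

  chamber-above : ∀ w → IncreasingOnInversions x w → Σ (Permutation′ n) λ v → (w ⟨$⟩ʳ_) ≤R (v ⟨$⟩ʳ_) × InC v x
  chamber-above w increasing =
    Climb.climb (IncreasingOnInversions x) (λ v → InC v x) advance w (≤R-refl (λ _ → refl)) increasing
    where
    advance : ∀ u → IncreasingOnInversions x u → InC u x ⊎ AscentInto (IncreasingOnInversions x) u
    advance u increasing with adjacent-search (λ i j → x (u ⟨$⟩ʳ j) <? x (u ⟨$⟩ʳ i))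
    ... | inj₁ (i , j , i⋖j , xuj<xui) = inj₂ (i , j , i⋖j , increasingOnInversions-swap {u} increasing i⋖j xuj<xui)
    ... | inj₂ sorted                  = inj₁ (λ i j i⋖j → ℚ.≮⇒≥ (sorted i⋖j))

proposition5p3 : (n : ℕ) (w : Permutation′ n) (x : Fin n → ℚ) →
    InDual w x ⇔
    Σ (Permutation′ n) (λ v → ((w ⟨$⟩ʳ_) ≤R (v ⟨$⟩ʳ_)) × ((v ⟨$⟩ʳ_) ≤R w₀) × InC v x)
proposition5p3 n w x = mk⇔
  (λ dual → let v , w≤v , v∈C = chamber-above x w (InDual⇒increasingOnInversions x w dual)
            in  v , w≤v , ≤R-w₀ v , v∈C)
  (λ (v , w≤v , _ , v∈C) → chamber⇒InDual w x {v} w≤v v∈C)
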